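{- Let $m\ge 3$ and $n\ge 3$ be integers. Then $$\chi_{\rho}(K_m, K_n) = mn - 2m + 2\,.$$
   Context: For graphs $G$ and $H$ and a function $f\colon V(G)\to V(H)$, the Sierpiński product $G\otimes_f H$ is the graph with vertex set $V(G)\times V(H)$ whose edges are: $(g,h)(g,h')$ for every $g\in V(G)$ and every edge $hh'\in E(H)$; and $(g,f(g'))(g',f(g))$ for every edge $gg'\in E(G)$. Let $H^G$ denote the set of all functions $V(G)\to V(H)$. For a graph $X$, a packing $k$-coloring is a map $c\colon V(X)\to\{1,\dots,k\}$ such that whenever $u\neq v$ and $c(u)=c(v)=\ell$, the shortest-path distance satisfies $d_X(u,v)>\ell$; the packing chromatic number $\chi_\rho(X)$ is the least $k$ for which a packing $k$-coloring exists. The Sierpiński packing chromatic number of the pair $(G,H)$ is $\chi_\rho(G,H)=\min_{f\in H^G}\chi_\rho(G\otimes_f H)$. $K_m$ denotes the complete graph on $m$ vertices. -}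

module Defs where

open import Level using (0ℓ)
open import Data.Nat using (ℕ; zero; suc; _≤_)
open import Data.Fin using (Fin)
open import Data.Product using (Σ; _×_; _,_; ∃)
open import Data.Sum using (_⊎_)
open import Relation.Nullary using (¬_)
open import Relation.Binary.PropositionalEquality using (_≡_; _≢_)

record Graph : Set₁ where
  field
    V   : Set
    Adj : V → V → Set
open Graph public

K : ℕ → Graph
K m = record { V = Fin m ; Adj = λ i j → i ≢ j }

Sierpinski : (G H : Graph) → (V G → V H) → Graph
Sierpinski G H f = record
  { V   = V G × V H
  ; Adj = λ { (g , h) (g' , h') →
              (g ≡ g' × Adj H h h')
            ⊎ (Adj G g g' × h ≡ f g' × h' ≡ f g) } }

data WithinDist (X : Graph) : ℕ → V X → V X → Set where
  here : ∀ {ℓ u} → WithinDist X ℓ u u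
  step : ∀ {ℓ u w v} → Adj X u w → WithinDist X ℓ w v → WithinDist X (suc ℓ) u v

IsPackingColoring : (X : Graph) (k : ℕ) → (V X → ℕ) → Set
IsPackingColoring X k c =
  (∀ v → 1 ≤ c v × c v ≤ k) ×
  (∀ u v → u ≢ v → c u ≡ c v → ¬ WithinDist X (c u) u v)

HasPackingColoring : Graph → ℕ → Set
HasPackingColoring X k = Σ (V X → ℕ) (IsPackingColoring X k)

PackingChromaticNumber : Graph → ℕ → Set
PackingChromaticNumber X k =
  HasPackingColoring X k × (∀ j → HasPackingColoring X j → k ≤ j)

SierpinskiPackingChromaticNumber : Graph → Graph → ℕ → Set
SierpinskiPackingChromaticNumber G H k =
  (∃ λ (f : V G → V H) → PackingChromaticNumber (Sierpinski G H f) k) ×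
  (∀ (f : V G → V H) j → PackingChromaticNumber (Sierpinski G H f) j → k ≤ j)

{-# OPTIONS --safe #-}
-- Lower bound: each fibre {g} × K_n of K_m ⊗_f K_n is a clique and the whole graph has
-- diameter at most 3, so colours 1 and 2 occur at most once per fibre and every colour
-- ℓ ≥ 3 occurs at most once overall; hence mn ≤ 2m + (k − 2) for a packing k-colouring.
-- Upper bound: for f constant with value b, vertices (g , h) and (g′ , h′) with g ≠ g′ and
-- h, h′ ≠ b are at distance ≥ 3, so two vertices ≠ b of every fibre can take colours 1
-- and 2, and the remaining m(n − 2) vertices receive distinct colours.
module Submission where

open import Defs
open import Data.Nat using (ℕ; suc; _≤_; _<_; _+_; _*_; _∸_; z≤n; s≤s; _≤?_; >-nonZero)
open import Data.Nat.Properties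
  using ( +-comm; *-comm; *-distribˡ-+; +-cancelˡ-≡; +-monoʳ-≤; *-monoˡ-<; <⇒≤; ≰⇒>
        ; <-≤-trans; m≤n+m; n>0⇒n≢0; m<n⇒0<n∸m; m∸n≢0⇒n<m; m+n∸m≡n
        ; m≤n+o⇒m∸n≤o; m≤o∸n⇒m+n≤o )
open import Data.Fin using (Fin; zero; suc; toℕ; fromℕ<; combine)
open import Data.Fin.Properties
  using (_≟_; toℕ-fromℕ<; toℕ<n; toℕ-injective; combine-injective; injective⇒≤; *↔×; +↔⊎)
open import Data.Product using (_×_; _,_; proj₁; proj₂)
open import Data.Product.Properties using (≡-dec)
open import Data.Sum using (_⊎_; inj₁; inj₂)
open import Data.Sum.Function.Propositional using (_⊎-↔_)
open import Function using (_∘_)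
open import Function.Bundles using (_↣_; mk↣; Injection)
open import Function.Construct.Composition using (_↣-∘_)
open import Function.Definitions using (Injective)
open import Function.Properties.Inverse using (↔-refl; ↔-sym; ↔-trans; ↔⇒↣)
open import Relation.Binary.Definitions using (DecidableEquality)
open import Relation.Nullary using (¬_; yes; no; contradiction)
open import Relation.Binary.PropositionalEquality
open ≡-Reasoning

module _ {X : Graph} where

  WithinDist-mono : ∀ {ℓ ℓ′ u v} → ℓ ≤ ℓ′ → WithinDist X ℓ u v → WithinDist X ℓ′ u v
  WithinDist-mono _           here         = here
  WithinDist-mono (s≤s ℓ≤ℓ′) (step uw wv) = step uw (WithinDist-mono ℓ≤ℓ′ wv)

  WithinDist-trans : ∀ {a b u v w} →
                     WithinDist X a u v → WithinDist X b v w → WithinDist X (a + b) u w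
  WithinDist-trans {a} {b} here vw = WithinDist-mono (m≤n+m b a) vw
  WithinDist-trans (step ux xv) vw = step ux (WithinDist-trans xv vw)

module _ {G : Graph} {n : ℕ} {f : V G → Fin n} where

  Sierpinski-fibre-clique : ∀ {u v : V G × Fin n} → u ≢ v → proj₁ u ≡ proj₁ v →
                            Adj (Sierpinski G (K n) f) u v
  Sierpinski-fibre-clique {g , h} {.g , h′} u≢v refl = inj₁ (refl , u≢v ∘ cong (g ,_))

  Sierpinski-fibre-WithinDist₁ : ∀ g h h′ →
                                 WithinDist (Sierpinski G (K n) f) 1 (g , h) (g , h′)
  Sierpinski-fibre-WithinDist₁ g h h′ with h ≟ h′
  ... | yes refl = here
  ... | no h≢h′  = step (inj₁ (refl , h≢h′)) here

SierpinskiK-diameter≤3 : ∀ {m n} (f : Fin m → Fin n) (u v : Fin m × Fin n) →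
                         WithinDist (Sierpinski (K m) (K n) f) 3 u v
SierpinskiK-diameter≤3 f (g , h) (g′ , h′) with g ≟ g′
... | yes refl = WithinDist-mono (s≤s z≤n) (Sierpinski-fibre-WithinDist₁ g h h′)
... | no g≢g′  =
  WithinDist-trans (Sierpinski-fibre-WithinDist₁ g h (f g′))
    (WithinDist-trans (step (inj₂ (g≢g′ , refl , refl)) (here {ℓ = 0}))
      (Sierpinski-fibre-WithinDist₁ g′ (f g) h′))

-- An edge leaving a fibre starts at a vertex (g , f g′), so a walk between vertices
-- outside the image of f must spend one edge in each fibre besides the crossing edge.
Sierpinski-nonImage-¬WithinDist₂ :
  ∀ {G H f g g′ h h′} → g ≢ g′ → (∀ x → h ≢ f x) → (∀ x → h′ ≢ f x) →
  ¬ WithinDist (Sierpinski G H f) 2 (g , h) (g′ , h′)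
Sierpinski-nonImage-¬WithinDist₂ g≢g′ _ _ here = g≢g′ refl
Sierpinski-nonImage-¬WithinDist₂ _ h∉f _ (step (inj₂ (_ , h≡f , _)) _) = h∉f _ h≡f
Sierpinski-nonImage-¬WithinDist₂ g≢g′ _ _ (step (inj₁ (refl , _)) here) = g≢g′ refl
Sierpinski-nonImage-¬WithinDist₂ g≢g′ _ _ (step (inj₁ (refl , _)) (step (inj₁ (refl , _)) here))
  = g≢g′ refl
Sierpinski-nonImage-¬WithinDist₂ _ _ h′∉f (step (inj₁ (refl , _)) (step (inj₂ (_ , _ , h′≡f)) here))
  = h′∉f _ h′≡f

-- A packing colouring is injective on the slots "colour 1 in fibre g", "colour 2 in
-- fibre g" and "colour ℓ ≥ 3"; colour 0, which a packing colouring never uses, is junk.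
Slot : ℕ → ℕ → Set
Slot m j = Fin 2 × Fin m ⊎ Fin (j ∸ 2)

colourSlot : ∀ {m j} → Fin m → (ℓ : ℕ) → ℓ ≤ j → Slot m j
colourSlot g 0 _ = inj₁ (zero , g)
colourSlot g 1 _ = inj₁ (zero , g)
colourSlot g 2 _ = inj₁ (suc zero , g)
colourSlot g (suc (suc (suc ℓ))) (s≤s (s≤s ℓ<j∸2)) = inj₂ (fromℕ< ℓ<j∸2)

slotColour : ∀ {A : Set} {r} → Fin 2 × A ⊎ Fin r → ℕ
slotColour (inj₁ (zero , _))     = 1
slotColour (inj₁ (suc zero , _)) = 2
slotColour (inj₂ i)              = 3 + toℕ i

slotColour-colourSlot : ∀ {m j g ℓ} {ℓ≤j : ℓ ≤ j} → 1 ≤ ℓ →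
                        slotColour (colourSlot {m} {j} g ℓ ℓ≤j) ≡ ℓ
slotColour-colourSlot {ℓ = 1} _ = refl
slotColour-colourSlot {ℓ = 2} _ = refl
slotColour-colourSlot {ℓ = suc (suc (suc _))} {s≤s (s≤s ℓ<j∸2)} _ =
  cong (3 +_) (toℕ-fromℕ< ℓ<j∸2)

colourSlot-fibre : ∀ {m j g g′ ℓ ℓ′} {ℓ≤j : ℓ ≤ j} {ℓ′≤j : ℓ′ ≤ j} → ℓ ≡ ℓ′ → ℓ < 3 →
                   colourSlot {m} g ℓ ℓ≤j ≡ colourSlot g′ ℓ′ ℓ′≤j → g ≡ g′
colourSlot-fibre {ℓ = 0} refl _ refl = refl
colourSlot-fibre {ℓ = 1} refl _ refl = refl
colourSlot-fibre {ℓ = 2} refl _ refl = refl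
colourSlot-fibre {ℓ = suc (suc (suc _))} refl (s≤s (s≤s (s≤s ()))) _

module PackingSlots {X : Graph} {m j : ℕ} (_≟V_ : DecidableEquality (V X))
                    (fibre : V X → Fin m)
                    (fibre-clique : ∀ {u v} → u ≢ v → fibre u ≡ fibre v → Adj X u v)
                    (diameter≤3 : ∀ u v → WithinDist X 3 u v)
                    {c : V X → ℕ} (c-packing : IsPackingColoring X j c) where

  slot : V X → Slot m j
  slot v = colourSlot (fibre v) (c v) (proj₂ (proj₁ c-packing v))

  slot-injective : Injective _≡_ _≡_ slot
  slot-injective {u} {v} slot-u≡slot-v with u ≟V v
  ... | yes u≡v = u≡v
  ... | no u≢v  = contradiction close (proj₂ c-packing u v u≢v cu≡cv)
    where
    1≤c : ∀ w → 1 ≤ c w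
    1≤c w = proj₁ (proj₁ c-packing w)

    cu≡cv : c u ≡ c v
    cu≡cv = begin
      c u                ≡⟨ slotColour-colourSlot (1≤c u) ⟨
      slotColour (slot u) ≡⟨ cong slotColour slot-u≡slot-v ⟩
      slotColour (slot v) ≡⟨ slotColour-colourSlot (1≤c v) ⟩
      c v                ∎

    close : WithinDist X (c u) u v
    close with 3 ≤? c u
    ... | yes 3≤cu = WithinDist-mono 3≤cu (diameter≤3 u v)
    ... | no 3≰cu  = WithinDist-mono (1≤c u)
      (step (fibre-clique u≢v (colourSlot-fibre cu≡cv (≰⇒> 3≰cu) slot-u≡slot-v)) here)

×↣×⊎⇒≤ : ∀ {m n k l r} → (Fin m × Fin n) ↣ (Fin k × Fin l ⊎ Fin r) → m * n ≤ k * l + r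
×↣×⊎⇒≤ ι = injective⇒≤ (Injection.injective
  (↔⇒↣ (↔-trans (↔-sym *↔× ⊎-↔ ↔-refl) (↔-sym +↔⊎)) ↣-∘ (ι ↣-∘ ↔⇒↣ *↔×)))

SierpinskiK-packing⇒count : ∀ {m n f j} → HasPackingColoring (Sierpinski (K m) (K n) f) j →
                            m * n ≤ 2 * m + (j ∸ 2)
SierpinskiK-packing⇒count {m} {f = f} (_ , c-packing) = ×↣×⊎⇒≤ (mk↣ slot-injective)
  where
  open PackingSlots (≡-dec _≟_ _≟_) proj₁ (Sierpinski-fibre-clique {K m})
                    (SierpinskiK-diameter≤3 f) c-packing

SierpinskiK-packing-lower-bound : ∀ {m n f j} → 1 ≤ m → 3 ≤ n →
                                  HasPackingColoring (Sierpinski (K m) (K n) f) j →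
                                  m * n ∸ 2 * m + 2 ≤ j
SierpinskiK-packing-lower-bound {m} {n} {j = j} 1≤m 3≤n colouring =
  m≤o∸n⇒m+n≤o _ 2≤j excess≤
  where
  excess≤ : m * n ∸ 2 * m ≤ j ∸ 2
  excess≤ = m≤n+o⇒m∸n≤o (m * n) (2 * m) (SierpinskiK-packing⇒count colouring)

  2m<mn : 2 * m < m * n
  2m<mn = subst (2 * m <_) (*-comm n m) (*-monoˡ-< m {{>-nonZero 1≤m}} 3≤n)

  2≤j : 2 ≤ j
  2≤j = <⇒≤ (m∸n≢0⇒n<m (n>0⇒n≢0 (<-≤-trans (m<n⇒0<n∸m 2m<mn) excess≤)))

hub : ∀ {k} → Fin (3 + k)
hub = suc (suc zero)

hubColouring : ∀ {m k} → Fin m × Fin (3 + k) → ℕ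
hubColouring (_ , zero)        = 1
hubColouring (_ , suc zero)    = 2
hubColouring (g , suc (suc i)) = 3 + toℕ (combine g i)

module _ {m k : ℕ} where

  private
    X : Graph
    X = Sierpinski (K m) (K (3 + k)) (λ _ → hub)

  hubColouring-range : ∀ (v : Fin m × Fin (3 + k)) →
                       1 ≤ hubColouring v × hubColouring v ≤ 2 + m * suc k
  hubColouring-range (_ , zero)        = s≤s z≤n , s≤s z≤n
  hubColouring-range (_ , suc zero)    = s≤s z≤n , s≤s (s≤s z≤n)
  hubColouring-range (g , suc (suc i)) = s≤s z≤n , +-monoʳ-≤ 2 (toℕ<n (combine g i))

  hubColouring-separated : ∀ u v → u ≢ v → hubColouring u ≡ hubColouring v →
                           ¬ WithinDist X (hubColouring u) u v
  hubColouring-separated (_ , zero) (_ , zero) u≢v _ =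
    Sierpinski-nonImage-¬WithinDist₂ (u≢v ∘ cong (_, zero)) (λ _ ()) (λ _ ())
    ∘ WithinDist-mono (s≤s z≤n)
  hubColouring-separated (_ , suc zero) (_ , suc zero) u≢v _ =
    Sierpinski-nonImage-¬WithinDist₂ (u≢v ∘ cong (_, suc zero)) (λ _ ()) (λ _ ())
  hubColouring-separated (g , suc (suc i)) (g′ , suc (suc i′)) u≢v same
    with refl , refl ← combine-injective g i g′ i′ (toℕ-injective (+-cancelˡ-≡ 3 _ _ same)) =
    contradiction refl u≢v
  hubColouring-separated (_ , zero)        (_ , suc zero)    _ ()
  hubColouring-separated (_ , zero)        (_ , suc (suc _)) _ ()
  hubColouring-separated (_ , suc zero)    (_ , zero)        _ ()
  hubColouring-separated (_ , suc zero)    (_ , suc (suc _)) _ ()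
  hubColouring-separated (_ , suc (suc _)) (_ , zero)        _ ()
  hubColouring-separated (_ , suc (suc _)) (_ , suc zero)    _ ()

  hubColouring-packing : HasPackingColoring X (m * (3 + k) ∸ 2 * m + 2)
  hubColouring-packing = hubColouring ,
    subst (λ j → IsPackingColoring X j (hubColouring {m} {k})) colours
          (hubColouring-range , hubColouring-separated)
    where
    colours : 2 + m * suc k ≡ m * (3 + k) ∸ 2 * m + 2
    colours = begin
      2 + m * suc k                  ≡⟨ +-comm 2 (m * suc k) ⟩
      m * suc k + 2                  ≡⟨ cong (_+ 2) (m+n∸m≡n (2 * m) (m * suc k)) ⟨
      2 * m + m * suc k ∸ 2 * m + 2  ≡⟨ cong (λ x → x + m * suc k ∸ 2 * m + 2) (*-comm 2 m) ⟩
      m * 2 + m * suc k ∸ 2 * m + 2  ≡⟨ cong (λ x → x ∸ 2 * m + 2) (*-distribˡ-+ m 2 (suc k)) ⟨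
      m * (3 + k) ∸ 2 * m + 2        ∎

theorem3p4 : (m n : ℕ) → 3 ≤ m → 3 ≤ n →
    SierpinskiPackingChromaticNumber (K m) (K n) (m * n ∸ 2 * m + 2)
theorem3p4 m n 3≤m 3≤n@(s≤s (s≤s (s≤s _))) =
  ((λ _ → hub) , hubColouring-packing , λ _ → lower-bound) ,
  λ _ _ optimal → lower-bound (proj₁ optimal)
  where
  lower-bound : ∀ {f j} → HasPackingColoring (Sierpinski (K m) (K n) f) j →
                m * n ∸ 2 * m + 2 ≤ j
  lower-bound = SierpinskiK-packing-lower-bound (<-≤-trans (s≤s z≤n) 3≤m) 3≤n
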